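{- Let $N$ be a positive integer, $\omega=e^{i\pi/N}$, and $n,p\ge0$ integers; put $M=2nN+N+2p$. Then for every $w\in\mathbb{C}$, \[ \sum_{k\ge0}\alpha_{k}^{(N)}\binom{M}{2kN+N}w^{2nN-2kN+2p}= \frac{1}{2^{N}} \sum_{\epsilon\in\{ -1,1\}^N} \pi(\epsilon) \left(w+\sum_{j=0}^{N-1}\epsilon_j \omega^{j}\right)^{M}, \] where terms with $2kN+N>M$ vanish.
   Context: The numbers $\alpha_k^{(N)}$ are defined by $\prod_{j=0}^{N-1}\sinh(\omega^{j}z)=\sum_{k\ge0}\alpha_{k}^{(N)}\frac{z^{2kN+N}}{(2kN+N)!}$ with $\omega=e^{i\pi/N}$. For a sign vector $\epsilon=(\epsilon_0,\dots,\epsilon_{N-1})\in\{ -1,1\}^N$, its signature is $\pi(\epsilon)=\prod_{j=0}^{N-1}\epsilon_j$. -}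

module Defs where

open import Level using (Level)
open import Algebra.Bundles using (CommutativeRing)
open import Data.Nat using (ℕ; zero; suc; _∸_)
import Data.Nat as ℕ
open import Data.Nat.Combinatorics using (_C_)
open import Data.Bool using (Bool; true; false)
open import Data.List using (List; []; _∷_; map; concatMap)
open import Data.Vec using (Vec; []; _∷_)

Mval : ℕ → ℕ → ℕ → ℕ
Mval N n p = 2 ℕ.* n ℕ.* N ℕ.+ N ℕ.+ 2 ℕ.* p

-- All sign vectors ε ∈ {-1,1}^N ; true = +1, false = -1
allSigns : (N : ℕ) → List (Vec Bool N)
allSigns zero = [] ∷ []
allSigns (suc N) = concatMap (λ v → (true ∷ v) ∷ (false ∷ v) ∷ []) (allSigns N)

module _ {c ℓ : Level} (R : CommutativeRing c ℓ) where
  open CommutativeRing R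

  pow : Carrier → ℕ → Carrier
  pow x zero = 1#
  pow x (suc m) = x * pow x m

  fromℕ : ℕ → Carrier
  fromℕ zero = 0#
  fromℕ (suc m) = 1# + fromℕ m

  sumTo : ℕ → (ℕ → Carrier) → Carrier
  sumTo zero f = 0#
  sumTo (suc m) f = sumTo m f + f m

  sumList : {A : Set} → List A → (A → Carrier) → Carrier
  sumList [] f = 0#
  sumList (x ∷ xs) f = f x + sumList xs f

  sgn : Bool → Carrier
  sgn true = 1#
  sgn false = - 1#

  signature : {N : ℕ} → Vec Bool N → Carrier
  signature [] = 1#
  signature (s ∷ ε) = sgn s * signature ε

  signedSumFrom : {N : ℕ} → Carrier → ℕ → Vec Bool N → Carrier
  signedSumFrom ω j [] = 0#
  signedSumFrom ω j (s ∷ ε) = sgn s * pow ω j + signedSumFrom ω (suc j) ε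

  signedSum : {N : ℕ} → Carrier → Vec Bool N → Carrier
  signedSum ω ε = signedSumFrom ω 0 ε

  -- coefficient of z^m/m! in sinh(a z):  a^m if m odd, 0 if m even
  sinhCoeff : Carrier → ℕ → Carrier
  sinhCoeff a zero = 0#
  sinhCoeff a (suc zero) = a
  sinhCoeff a (suc (suc m)) = a * a * sinhCoeff a m

  -- coefficient of z^m/m! in ∏_{j<t} sinh(ω^j z), computed by the
  -- product rule for exponential generating functions:
  --   (f g)_m = Σ_{i ≤ m} C(m,i) f_i g_{m-i}
  sinhProdCoeff : Carrier → ℕ → ℕ → Carrier
  sinhProdCoeff ω zero zero = 1#
  sinhProdCoeff ω zero (suc m) = 0#
  sinhProdCoeff ω (suc t) m =
    sumTo (suc m) (λ i → fromℕ (m C i) * (sinhProdCoeff ω t i * sinhCoeff (pow ω t) (m ∸ i)))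

  -- α_k^{(N)} = coefficient of z^{2kN+N}/(2kN+N)! in ∏_{j<N} sinh(ω^j z)
  alpha : Carrier → ℕ → ℕ → Carrier
  alpha ω N k = sinhProdCoeff ω N (2 ℕ.* k ℕ.* N ℕ.+ N)

-- Writing S_ε = Σ_j ε_j ω^j, one has ∏_{j<N} sinh(ω^j z) = 2^{-N} Σ_ε π(ε) e^{S_ε z}, so the
-- coefficient of z^i/i! in the product is 2^{-N} X_i with X_i = Σ_ε π(ε) S_ε^i.  Multiplying by
-- e^{wz} and taking the coefficient of z^M/M! gives the right-hand side.  Replacing S_ε by ω S_ε
-- shifts every exponent by one, and since ω^N = -1 the shifted sign sum is the negated one:
-- ω^i X_i = -X_i.  As ω is a primitive 2N-th root of unity, ω^i = -1 only for i ≡ N (mod 2N),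
-- so in an integral domain X_i vanishes for all other i, which leaves exactly the left-hand side.
module Submission where

open import Defs
open import Algebra.Bundles using (CommutativeRing)
open import Data.Bool using (Bool; true; false)
open import Data.Empty using (⊥-elim)
open import Data.Fin using (toℕ)
open import Data.List using (List; []; _∷_; concatMap)
open import Data.Nat using (ℕ; zero; suc; _∸_; _≤_; _<_; z≤n; s≤s; NonZero)
import Data.Nat as ℕ
import Data.Nat.Properties as ℕₚ
open import Data.Nat.Combinatorics using (_C_)
open import Data.Nat.Combinatorics.Specification using (k>n⇒nCk≡0)
open import Data.Nat.DivMod using (_%_; _/_; m≡m%n+[m/n]*n; m%n<n; [m+kn]%n≡m%n; m<n⇒m%n≡m)
open import Data.Nat.Tactic.RingSolver using (solve-∀)
open import Data.Sum using (_⊎_; inj₁; inj₂)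
open import Data.Vec using (Vec; []; _∷_)
open import Relation.Binary.Definitions using (tri<; tri≈; tri>)
open import Relation.Binary.PropositionalEquality as ≡ using (_≡_; _≢_)
open import Relation.Nullary using (¬_)
import Relation.Binary.Reasoning.Setoid as SetoidReasoning
import Algebra.Solver.Ring.NaturalCoefficients.Default as NaturalCoefficients

module Properties {c ℓ} (R : CommutativeRing c ℓ) where
  open CommutativeRing R
  open SetoidReasoning setoid
  open import Algebra.Definitions _≈_ using (Congruent₁)
  open import Algebra.Properties.Ring ring
    using (-‿distribˡ-*; -‿distribʳ-*; -1*x≈-x; -‿involutive; -‿injective; ⁻¹-anti-homo‿-;
           x[y-z]≈xy-xz; +-inverseˡ-unique)
  open import Algebra.Properties.CommutativeSemigroup *-commutativeSemigroup using (x∙yz≈y∙xz)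
  open NaturalCoefficients commutativeSemiring using (solve; _:=_; _:+_; _:*_)

  2# : Carrier
  2# = 1# + 1#

  [x-y]-[z-u]≈[x-z]-[y-u] : ∀ x y z u → (x - y) - (z - u) ≈ (x - z) - (y - u)
  [x-y]-[z-u]≈[x-z]-[y-u] x y z u = begin
    (x - y) - (z - u)       ≈⟨ +-congˡ (⁻¹-anti-homo‿- z u) ⟩
    (x - y) + (u - z)
      ≈⟨ solve 4 (λ x y z u → (x :+ y) :+ (u :+ z) := (x :+ z) :+ (u :+ y)) refl x (- y) (- z) u ⟩
    (x - z) + (u - y)       ≈⟨ +-congˡ (⁻¹-anti-homo‿- y u) ⟨
    (x - z) - (y - u)       ∎

  pow-cong : ∀ m {x y} → x ≈ y → pow R x m ≈ pow R y m
  pow-cong zero    _   = refl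
  pow-cong (suc m) x≈y = *-cong x≈y (pow-cong m x≈y)

  pow-+ : ∀ x a b → pow R x (a ℕ.+ b) ≈ pow R x a * pow R x b
  pow-+ x zero    b = sym (*-identityˡ _)
  pow-+ x (suc a) b = trans (*-congˡ (pow-+ x a b)) (sym (*-assoc _ _ _))

  pow-* : ∀ x y m → pow R (x * y) m ≈ pow R x m * pow R y m
  pow-* x y zero    = sym (*-identityˡ 1#)
  pow-* x y (suc m) = trans (*-congˡ (pow-* x y m))
    (solve 4 (λ x y a b → (x :* y) :* (a :* b) := (x :* a) :* (y :* b)) refl x y (pow R x m) (pow R y m))

  pow-1# : ∀ m → pow R 1# m ≈ 1#
  pow-1# zero    = refl
  pow-1# (suc m) = trans (*-identityˡ _) (pow-1# m)

  pow-% : ∀ x {q} .{{_ : NonZero q}} → pow R x q ≈ 1# → ∀ i → pow R x i ≈ pow R x (i % q)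
  pow-% x {q} xᵠ≈1 i = begin
    pow R x i                                   ≡⟨ ≡.cong (pow R x) (m≡m%n+[m/n]*n i q) ⟩
    pow R x (i % q ℕ.+ (i / q) ℕ.* q)           ≈⟨ pow-+ x (i % q) _ ⟩
    pow R x (i % q) * pow R x ((i / q) ℕ.* q)   ≈⟨ *-congˡ (pow-multiple (i / q)) ⟩
    pow R x (i % q) * 1#                        ≈⟨ *-identityʳ _ ⟩
    pow R x (i % q)                             ∎
    where
    pow-multiple : ∀ k → pow R x (k ℕ.* q) ≈ 1#
    pow-multiple zero    = refl
    pow-multiple (suc k) = trans (pow-+ x q (k ℕ.* q)) (trans (*-cong xᵠ≈1 (pow-multiple k)) (*-identityˡ 1#))

  pow-∸≈1 : ∀ x {a b} → a ≤ b → pow R x a ≈ - 1# → pow R x b ≈ - 1# → pow R x (b ∸ a) ≈ 1#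
  pow-∸≈1 x {a} {b} a≤b xᵃ≈-1 xᵇ≈-1 = -‿injective (begin
    - pow R x (b ∸ a)                    ≈⟨ -‿cong (*-identityʳ _) ⟨
    - (pow R x (b ∸ a) * 1#)             ≈⟨ -‿distribʳ-* _ 1# ⟩
    pow R x (b ∸ a) * - 1#               ≈⟨ *-congˡ xᵃ≈-1 ⟨
    pow R x (b ∸ a) * pow R x a          ≈⟨ pow-+ x (b ∸ a) a ⟨
    pow R x (b ∸ a ℕ.+ a)                ≡⟨ ≡.cong (pow R x) (ℕₚ.m∸n+n≡m a≤b) ⟩
    pow R x b                            ≈⟨ xᵇ≈-1 ⟩
    - 1#                                 ∎)

  pow≈-1⇒%≡ : ∀ {x} t → pow R x (suc t) ≈ - 1# → (∀ d → 1 ≤ d → d < 2 ℕ.* suc t → ¬ (pow R x d ≈ 1#)) →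
    ∀ i → pow R x i ≈ - 1# → i % (2 ℕ.* suc t) ≡ suc t
  pow≈-1⇒%≡ {x} t xᴺ≈-1 x-primitive i xⁱ≈-1 = below-2N (m%n<n i q) (trans (sym (pow-% x xᵠ≈1 i)) xⁱ≈-1)
    where
    N q : ℕ
    N = suc t
    q = 2 ℕ.* N

    N<q : N < q
    N<q = ℕₚ.m<m+n N (s≤s z≤n)

    xᵠ≈1 : pow R x q ≈ 1#
    xᵠ≈1 = begin
      pow R x (N ℕ.+ (N ℕ.+ 0))    ≈⟨ pow-+ x N (N ℕ.+ 0) ⟩
      pow R x N * pow R x (N ℕ.+ 0) ≡⟨ ≡.cong (λ e → pow R x N * pow R x e) (ℕₚ.+-identityʳ N) ⟩
      pow R x N * pow R x N        ≈⟨ *-cong xᴺ≈-1 xᴺ≈-1 ⟩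
      - 1# * - 1#                  ≈⟨ -1*x≈-x (- 1#) ⟩
      - - 1#                       ≈⟨ -‿involutive 1# ⟩
      1#                           ∎

    below-2N : ∀ {r} → r < q → pow R x r ≈ - 1# → r ≡ N
    below-2N {r} r<q xʳ≈-1 with ℕₚ.<-cmp r N
    ... | tri≈ _ r≡N _ = r≡N
    ... | tri< r<N _ _ = ⊥-elim (x-primitive (N ∸ r) (ℕₚ.m<n⇒0<n∸m r<N) (ℕₚ.≤-<-trans (ℕₚ.m∸n≤m N r) N<q)
                                  (pow-∸≈1 x (ℕₚ.<⇒≤ r<N) xʳ≈-1 xᴺ≈-1))
    ... | tri> _ _ N<r = ⊥-elim (x-primitive (r ∸ N) (ℕₚ.m<n⇒0<n∸m N<r) (ℕₚ.≤-<-trans (ℕₚ.m∸n≤m r N) r<q)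
                                  (pow-∸≈1 x (ℕₚ.<⇒≤ N<r) xᴺ≈-1 xʳ≈-1))

  sumTo-cong : ∀ n {f g : ℕ → Carrier} → (∀ i → f i ≈ g i) → sumTo R n f ≈ sumTo R n g
  sumTo-cong zero    f≈g = refl
  sumTo-cong (suc n) f≈g = +-cong (sumTo-cong n f≈g) (f≈g n)

  sumTo-+ : ∀ n (f g : ℕ → Carrier) → sumTo R n (λ i → f i + g i) ≈ sumTo R n f + sumTo R n g
  sumTo-+ zero    f g = sym (+-identityˡ 0#)
  sumTo-+ (suc n) f g = trans (+-congʳ (sumTo-+ n f g))
    (solve 4 (λ a b c d → (a :+ b) :+ (c :+ d) := (a :+ c) :+ (b :+ d)) refl
       (sumTo R n f) (sumTo R n g) (f n) (g n))

  sumTo-*ˡ : ∀ n k (f : ℕ → Carrier) → k * sumTo R n f ≈ sumTo R n (λ i → k * f i)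
  sumTo-*ˡ zero    k f = zeroʳ k
  sumTo-*ˡ (suc n) k f = trans (distribˡ k _ _) (+-congʳ (sumTo-*ˡ n k f))

  sumTo-sub : ∀ n (f g : ℕ → Carrier) → sumTo R n (λ i → f i - g i) ≈ sumTo R n f - sumTo R n g
  sumTo-sub n f g = begin
    sumTo R n (λ i → f i - g i)              ≈⟨ sumTo-+ n f (λ i → - g i) ⟩
    sumTo R n f + sumTo R n (λ i → - g i)    ≈⟨ +-congˡ (sumTo-cong n (λ i → -1*x≈-x (g i))) ⟨
    sumTo R n f + sumTo R n (λ i → - 1# * g i) ≈⟨ +-congˡ (sumTo-*ˡ n (- 1#) g) ⟨
    sumTo R n f + - 1# * sumTo R n g         ≈⟨ +-congˡ (-1*x≈-x _) ⟩
    sumTo R n f - sumTo R n g                ∎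

  sumTo-zero : ∀ n (f : ℕ → Carrier) → (∀ i → i < n → f i ≈ 0#) → sumTo R n f ≈ 0#
  sumTo-zero zero    f f≈0 = refl
  sumTo-zero (suc n) f f≈0 =
    trans (+-cong (sumTo-zero n f (λ i i<n → f≈0 i (ℕₚ.m<n⇒m<1+n i<n))) (f≈0 n (ℕₚ.n<1+n n))) (+-identityˡ 0#)

  sumTo-extend : ∀ {a b} (f : ℕ → Carrier) → a ≤ b → (∀ i → a ≤ i → f i ≈ 0#) → sumTo R b f ≈ sumTo R a f
  sumTo-extend {b = zero}  f z≤n f≈0 = refl
  sumTo-extend {b = suc b} f a≤1+b f≈0 with ℕₚ.m≤n⇒m<n∨m≡n a≤1+b
  ... | inj₂ ≡.refl         = refl
  ... | inj₁ (s≤s a≤b)      = trans (+-cong (sumTo-extend f a≤b f≈0) (f≈0 b a≤b)) (+-identityʳ _)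

  sumTo-single : ∀ {q c} (f : ℕ → Carrier) → c < q → (∀ r → r < q → r ≢ c → f r ≈ 0#) → sumTo R q f ≈ f c
  sumTo-single {suc q} f c<1+q f≈0 with ℕₚ.m≤n⇒m<n∨m≡n c<1+q
  ... | inj₂ ≡.refl = trans (+-congʳ (sumTo-zero q f (λ r r<q → f≈0 r (ℕₚ.m<n⇒m<1+n r<q) (ℕₚ.<⇒≢ r<q))))
                            (+-identityˡ _)
  ... | inj₁ (s≤s c<q) = trans (+-cong (sumTo-single f c<q (λ r r<q → f≈0 r (ℕₚ.m<n⇒m<1+n r<q)))
                                       (f≈0 q (ℕₚ.n<1+n q) (ℕₚ.>⇒≢ c<q)))
                               (+-identityʳ _)

  sumTo-split : ∀ a b (f : ℕ → Carrier) → sumTo R (a ℕ.+ b) f ≈ sumTo R a f + sumTo R b (λ r → f (a ℕ.+ r))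
  sumTo-split a zero    f rewrite ℕₚ.+-identityʳ a = sym (+-identityʳ _)
  sumTo-split a (suc b) f rewrite ℕₚ.+-suc a b = trans (+-congʳ (sumTo-split a b f)) (+-assoc _ _ _)

  sumTo-blocks : ∀ K q (f : ℕ → Carrier) →
    sumTo R (K ℕ.* q) f ≈ sumTo R K (λ k → sumTo R q (λ r → f (k ℕ.* q ℕ.+ r)))
  sumTo-blocks zero    q f = refl
  sumTo-blocks (suc K) q f rewrite ℕₚ.+-comm q (K ℕ.* q) =
    trans (sumTo-split (K ℕ.* q) q f) (+-congʳ (sumTo-blocks K q f))

  sumTo-sparse : ∀ K {q c} .{{_ : NonZero q}} (f : ℕ → Carrier) → c < q → (∀ i → i % q ≢ c → f i ≈ 0#) →
    sumTo R (K ℕ.* q) f ≈ sumTo R K (λ k → f (k ℕ.* q ℕ.+ c))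
  sumTo-sparse K {q} {c} f c<q f≈0 = trans (sumTo-blocks K q f) (sumTo-cong K block)
    where
    residue : ∀ k {r} → r < q → (k ℕ.* q ℕ.+ r) % q ≡ r
    residue k {r} r<q = ≡.trans (≡.cong (_% q) (ℕₚ.+-comm (k ℕ.* q) r))
                          (≡.trans ([m+kn]%n≡m%n r k q) (m<n⇒m%n≡m r<q))

    block : ∀ k → sumTo R q (λ r → f (k ℕ.* q ℕ.+ r)) ≈ f (k ℕ.* q ℕ.+ c)
    block k = sumTo-single _ c<q (λ r r<q r≢c → f≈0 _ (λ ≡c → r≢c (≡.trans (≡.sym (residue k r<q)) ≡c)))

  binomial : ∀ m x y →
    pow R (x + y) m ≈ sumTo R (suc m) (λ i → fromℕ R (m C i) * (pow R x i * pow R y (m ∸ i)))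
  binomial m x y = begin
    pow R (x + y) m                   ≈⟨ pow≈^ (x + y) m ⟩
    (x + y) ^ m                       ≈⟨ Binomial.theorem m x y ⟩
    Binomial.binomialExpansion x y m  ≈⟨ sum≈sumTo (suc m) (λ i → (m C i) × (x ^ i * y ^ (m ∸ i))) ⟩
    sumTo R (suc m) (λ i → (m C i) × (x ^ i * y ^ (m ∸ i)))
      ≈⟨ sumTo-cong (suc m) (λ i → trans (×≈fromℕ* (m C i) _)
                                     (*-congˡ (sym (*-cong (pow≈^ x i) (pow≈^ y (m ∸ i)))))) ⟩
    sumTo R (suc m) (λ i → fromℕ R (m C i) * (pow R x i * pow R y (m ∸ i))) ∎
    where
    open import Algebra.Properties.Semiring.Exp semiring using (_^_)
    open import Algebra.Definitions.RawMonoid +-rawMonoid using (_×_; sum)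
    import Algebra.Properties.CommutativeSemiring.Binomial commutativeSemiring as Binomial

    pow≈^ : ∀ x m → pow R x m ≈ x ^ m
    pow≈^ x zero    = refl
    pow≈^ x (suc m) = *-congˡ (pow≈^ x m)

    ×≈fromℕ* : ∀ m x → m × x ≈ fromℕ R m * x
    ×≈fromℕ* zero    x = sym (zeroˡ x)
    ×≈fromℕ* (suc m) x = trans (+-cong (sym (*-identityˡ x)) (×≈fromℕ* m x)) (sym (distribʳ x 1# (fromℕ R m)))

    sum≈sumTo : ∀ n (f : ℕ → Carrier) → sum {n} (λ i → f (toℕ i)) ≈ sumTo R n f
    sum≈sumTo zero    f = refl
    sum≈sumTo (suc n) f = begin
      f 0 + sum {n} (λ i → f (suc (toℕ i)))   ≈⟨ +-congˡ (sum≈sumTo n (λ i → f (suc i))) ⟩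
      f 0 + sumTo R n (λ i → f (suc i))   ≈⟨ shift n ⟨
      sumTo R (suc n) f                   ∎
      where
      shift : ∀ n → sumTo R (suc n) f ≈ f 0 + sumTo R n (λ i → f (suc i))
      shift zero    = trans (+-identityˡ _) (sym (+-identityʳ _))
      shift (suc n) = trans (+-congʳ (shift n)) (+-assoc _ _ _)

  sumList-cong : ∀ {A : Set} (xs : List A) {f g : A → Carrier} → (∀ x → f x ≈ g x) →
    sumList R xs f ≈ sumList R xs g
  sumList-cong []       f≈g = refl
  sumList-cong (x ∷ xs) f≈g = +-cong (f≈g x) (sumList-cong xs f≈g)

  sumList-0 : ∀ {A : Set} (xs : List A) → sumList R xs (λ _ → 0#) ≈ 0#
  sumList-0 []       = refl
  sumList-0 (x ∷ xs) = trans (+-identityˡ _) (sumList-0 xs)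

  sumList-+ : ∀ {A : Set} (xs : List A) (f g : A → Carrier) →
    sumList R xs (λ x → f x + g x) ≈ sumList R xs f + sumList R xs g
  sumList-+ []       f g = sym (+-identityˡ 0#)
  sumList-+ (x ∷ xs) f g = trans (+-congˡ (sumList-+ xs f g))
    (solve 4 (λ a b c d → (a :+ b) :+ (c :+ d) := (a :+ c) :+ (b :+ d)) refl
       (f x) (g x) (sumList R xs f) (sumList R xs g))

  sumList-*ˡ : ∀ {A : Set} (xs : List A) k (f : A → Carrier) →
    k * sumList R xs f ≈ sumList R xs (λ x → k * f x)
  sumList-*ˡ []       k f = zeroʳ k
  sumList-*ˡ (x ∷ xs) k f = trans (distribˡ k _ _) (+-congˡ (sumList-*ˡ xs k f))

  sumList-allSigns-suc : ∀ t (f : Vec Bool (suc t) → Carrier) →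
    sumList R (allSigns (suc t)) f ≈ sumList R (allSigns t) (λ v → f (true ∷ v) + f (false ∷ v))
  sumList-allSigns-suc t f = pairs (allSigns t)
    where
    pairs : ∀ vs → sumList R (concatMap (λ v → (true ∷ v) ∷ (false ∷ v) ∷ []) vs) f
                ≈ sumList R vs (λ v → f (true ∷ v) + f (false ∷ v))
    pairs []       = refl
    pairs (v ∷ vs) = trans (sym (+-assoc _ _ _)) (+-congˡ (pairs vs))

  sinhCoeff-double : ∀ a m → 2# * sinhCoeff R a m ≈ pow R a m - pow R (- a) m
  sinhCoeff-double a zero          = trans (zeroʳ _) (sym (-‿inverseʳ 1#))
  sinhCoeff-double a (suc zero)    = begin
    2# * a                   ≈⟨ trans (distribʳ a 1# 1#) (+-cong (*-identityˡ a) (*-identityˡ a)) ⟩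
    a + a                    ≈⟨ +-cong (*-identityʳ a) (trans (-‿cong (*-identityʳ (- a))) (-‿involutive a)) ⟨
    a * 1# - (- a) * 1#      ∎
  sinhCoeff-double a (suc (suc m)) = begin
    2# * (a * a * sinhCoeff R a m)          ≈⟨ x∙yz≈y∙xz 2# (a * a) _ ⟩
    a * a * (2# * sinhCoeff R a m)          ≈⟨ *-congˡ (sinhCoeff-double a m) ⟩
    a * a * (pow R a m - pow R (- a) m)     ≈⟨ x[y-z]≈xy-xz (a * a) _ _ ⟩
    a * a * pow R a m - a * a * pow R (- a) m
      ≈⟨ +-cong (*-assoc _ _ _) (-‿cong (trans (*-congʳ a²≈[-a]²) (*-assoc _ _ _))) ⟩
    a * (a * pow R a m) - (- a) * ((- a) * pow R (- a) m) ∎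
    where
    a²≈[-a]² : a * a ≈ (- a) * (- a)
    a²≈[-a]² = begin
      a * a            ≈⟨ -‿involutive _ ⟨
      - - (a * a)      ≈⟨ -‿cong (-‿distribʳ-* a a) ⟩
      - (a * - a)      ≈⟨ -‿distribˡ-* a (- a) ⟩
      (- a) * (- a)    ∎

  module SignSums (ω : Carrier) where

    Δ : Carrier → (Carrier → Carrier) → Carrier → Carrier
    Δ a g s = g (a + s) - g (- a + s)

    Δ-congruent : ∀ a {g} → Congruent₁ g → Congruent₁ (Δ a g)
    Δ-congruent a g-cong x≈y = +-cong (g-cong (+-congˡ x≈y)) (-‿cong (g-cong (+-congˡ x≈y)))

    Δ-congˡ : ∀ {a b g} → Congruent₁ g → a ≈ b → ∀ s → Δ a g s ≈ Δ b g s
    Δ-congˡ g-cong a≈b s = +-cong (g-cong (+-congʳ a≈b)) (-‿cong (g-cong (+-congʳ (-‿cong a≈b))))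

    Δ-neg : ∀ a {g} → Congruent₁ g → ∀ s → Δ (- a) g s ≈ - Δ a g s
    Δ-neg a g-cong s = trans (+-congˡ (-‿cong (g-cong (+-congʳ (-‿involutive a)))))
                             (sym (⁻¹-anti-homo‿- _ _))

    Δ-comm : ∀ a b {g} → Congruent₁ g → ∀ s → Δ a (Δ b g) s ≈ Δ b (Δ a g) s
    Δ-comm a b {g} g-cong s = trans
      (+-cong (+-cong (g-cong (swap b a s)) (-‿cong (g-cong (swap (- b) a s))))
              (-‿cong (+-cong (g-cong (swap b (- a) s)) (-‿cong (g-cong (swap (- b) (- a) s))))))
      ([x-y]-[z-u]≈[x-z]-[y-u] _ _ _ _)
      where
      swap : ∀ x y z → x + (y + z) ≈ y + (x + z)
      swap = solve 3 (λ x y z → x :+ (y :+ z) := y :+ (x :+ z)) refl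

    -- Unfolding one sign at a time (signSum-suc), signSum j t g is the iterated difference
    -- Δ_{ω^j} ⋯ Δ_{ω^{j+t-1}} g evaluated at 0.
    signSum : ℕ → ℕ → (Carrier → Carrier) → Carrier
    signSum j t g = sumList R (allSigns t) (λ ε → signature R ε * g (signedSumFrom R ω j ε))

    signSum-cong : ∀ j t {g h} → (∀ s → g s ≈ h s) → signSum j t g ≈ signSum j t h
    signSum-cong j t g≈h = sumList-cong (allSigns t) (λ ε → *-congˡ (g≈h _))

    signSum-+ : ∀ j t g h → signSum j t (λ s → g s + h s) ≈ signSum j t g + signSum j t h
    signSum-+ j t g h = trans (sumList-cong (allSigns t) (λ ε → distribˡ _ _ _)) (sumList-+ (allSigns t) _ _)

    signSum-*ˡ : ∀ j t k g → signSum j t (λ s → k * g s) ≈ k * signSum j t g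
    signSum-*ˡ j t k g =
      trans (sumList-cong (allSigns t) (λ ε → x∙yz≈y∙xz _ k _)) (sym (sumList-*ˡ (allSigns t) k _))

    signSum-neg : ∀ j t g → signSum j t (λ s → - g s) ≈ - signSum j t g
    signSum-neg j t g = begin
      signSum j t (λ s → - g s)       ≈⟨ signSum-cong j t (λ s → -1*x≈-x (g s)) ⟨
      signSum j t (λ s → - 1# * g s)  ≈⟨ signSum-*ˡ j t (- 1#) g ⟩
      - 1# * signSum j t g            ≈⟨ -1*x≈-x _ ⟩
      - signSum j t g                 ∎

    signSum-sumTo : ∀ j t n (h : ℕ → Carrier → Carrier) →
      signSum j t (λ s → sumTo R n (λ i → h i s)) ≈ sumTo R n (λ i → signSum j t (h i))
    signSum-sumTo j t zero    h = trans (sumList-cong (allSigns t) (λ ε → zeroʳ _)) (sumList-0 (allSigns t))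
    signSum-sumTo j t (suc n) h =
      trans (signSum-+ j t (λ s → sumTo R n (λ i → h i s)) (h n)) (+-congʳ (signSum-sumTo j t n h))

    signSum-suc : ∀ j t {g} → Congruent₁ g → signSum j (suc t) g ≈ signSum (suc j) t (Δ (pow R ω j) g)
    signSum-suc j t {g} g-cong =
      trans (sumList-allSigns-suc t _) (sumList-cong (allSigns t) pair)
      where
      a : Carrier
      a = pow R ω j

      pair : ∀ ε → let S = signedSumFrom R ω (suc j) ε; σ = signature R ε in
        (1# * σ) * g (1# * a + S) + (- 1# * σ) * g (- 1# * a + S) ≈ σ * Δ a g S
      pair ε = let S = signedSumFrom R ω (suc j) ε; σ = signature R ε in begin
        (1# * σ) * g (1# * a + S) + (- 1# * σ) * g (- 1# * a + S)
          ≈⟨ +-cong (*-cong (*-identityˡ σ) (g-cong (+-congʳ (*-identityˡ a))))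
                    (*-cong (-1*x≈-x σ) (g-cong (+-congʳ (-1*x≈-x a)))) ⟩
        σ * g (a + S) + - σ * g (- a + S)
          ≈⟨ +-congˡ (trans (sym (-‿distribˡ-* σ _)) (-‿distribʳ-* σ _)) ⟩
        σ * g (a + S) + σ * - g (- a + S)
          ≈⟨ distribˡ σ _ _ ⟨
        σ * Δ a g S ∎

    signSum-sucʳ : ∀ j t {g} → Congruent₁ g → signSum j (suc t) g ≈ signSum j t (Δ (pow R ω (j ℕ.+ t)) g)
    signSum-sucʳ j zero    g-cong =
      trans (signSum-suc j 0 g-cong)
            (signSum-cong j 0 (Δ-congˡ g-cong (reflexive (≡.cong (pow R ω) (≡.sym (ℕₚ.+-identityʳ j))))))
    signSum-sucʳ j (suc t) {g} g-cong = begin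
      signSum j (suc (suc t)) g                          ≈⟨ signSum-suc j (suc t) g-cong ⟩
      signSum (suc j) (suc t) (Δ ωʲ g)                   ≈⟨ signSum-sucʳ (suc j) t (Δ-congruent ωʲ g-cong) ⟩
      signSum (suc j) t (Δ (pow R ω (suc j ℕ.+ t)) (Δ ωʲ g))
        ≈⟨ signSum-cong (suc j) t (λ s → trans (Δ-congˡ (Δ-congruent ωʲ g-cong) reindex s)
                                               (Δ-comm ωᵏ ωʲ g-cong s)) ⟩
      signSum (suc j) t (Δ ωʲ (Δ ωᵏ g))                  ≈⟨ signSum-suc j t (Δ-congruent ωᵏ g-cong) ⟨
      signSum j (suc t) (Δ ωᵏ g)                         ∎
      where
      ωʲ ωᵏ : Carrier
      ωʲ = pow R ω j
      ωᵏ = pow R ω (j ℕ.+ suc t)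

      reindex : pow R ω (suc j ℕ.+ t) ≈ ωᵏ
      reindex = reflexive (≡.cong (pow R ω) (≡.sym (ℕₚ.+-suc j t)))

    signedSumFrom-dilate : ∀ {t} j (ε : Vec Bool t) → ω * signedSumFrom R ω j ε ≈ signedSumFrom R ω (suc j) ε
    signedSumFrom-dilate j []      = zeroʳ ω
    signedSumFrom-dilate j (e ∷ ε) =
      trans (distribˡ ω _ _) (+-cong (x∙yz≈y∙xz ω (sgn R e) _) (signedSumFrom-dilate (suc j) ε))

    signSum-dilate : ∀ j t {g} → Congruent₁ g → signSum j t (λ s → g (ω * s)) ≈ signSum (suc j) t g
    signSum-dilate j t g-cong = sumList-cong (allSigns t) (λ ε → *-congˡ (g-cong (signedSumFrom-dilate j ε)))

    -- ω^N = -1 turns the last difference Δ_{ω^N} into Δ_{-1} = -Δ_1, and Δ_1 = Δ_{ω^0} is the first one.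
    signSum-antisym : ∀ t → pow R ω (suc t) ≈ - 1# → ∀ {g} → Congruent₁ g →
      signSum 1 (suc t) g ≈ - signSum 0 (suc t) g
    signSum-antisym t ωᴺ≈-1 {g} g-cong = begin
      signSum 1 (suc t) g                      ≈⟨ signSum-sucʳ 1 t g-cong ⟩
      signSum 1 t (Δ (pow R ω (suc t)) g)      ≈⟨ signSum-cong 1 t (Δ-congˡ g-cong ωᴺ≈-1) ⟩
      signSum 1 t (Δ (- 1#) g)                 ≈⟨ signSum-cong 1 t (Δ-neg 1# g-cong) ⟩
      signSum 1 t (λ s → - Δ 1# g s)           ≈⟨ signSum-neg 1 t (Δ 1# g) ⟩
      - signSum 1 t (Δ 1# g)                   ≈⟨ -‿cong (signSum-suc 0 t g-cong) ⟨
      - signSum 0 (suc t) g                    ∎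

    signSum-pow-annihilated : ∀ t → pow R ω (suc t) ≈ - 1# → ∀ i →
      (pow R ω i + 1#) * signSum 0 (suc t) (λ s → pow R s i) ≈ 0#
    signSum-pow-annihilated t ωᴺ≈-1 i = begin
      (pow R ω i + 1#) * X       ≈⟨ distribʳ X _ _ ⟩
      pow R ω i * X + 1# * X     ≈⟨ +-cong ωⁱX≈-X (*-identityˡ X) ⟩
      - X + X                    ≈⟨ -‿inverseˡ X ⟩
      0#                         ∎
      where
      X : Carrier
      X = signSum 0 (suc t) (λ s → pow R s i)

      ωⁱX≈-X : pow R ω i * X ≈ - X
      ωⁱX≈-X = begin
        pow R ω i * X                                      ≈⟨ signSum-*ˡ 0 (suc t) _ (λ s → pow R s i) ⟨
        signSum 0 (suc t) (λ s → pow R ω i * pow R s i)    ≈⟨ signSum-cong 0 (suc t) (λ s → pow-* ω s i) ⟨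
        signSum 0 (suc t) (λ s → pow R (ω * s) i)          ≈⟨ signSum-dilate 0 (suc t) (pow-cong i) ⟩
        signSum 1 (suc t) (λ s → pow R s i)                ≈⟨ signSum-antisym t ωᴺ≈-1 (pow-cong i) ⟩
        - X                                                ∎

    Δ-pow : ∀ a m s → Δ a (λ x → pow R x m) s
      ≈ sumTo R (suc m) (λ i → fromℕ R (m C i) * (pow R s i * (pow R a (m ∸ i) - pow R (- a) (m ∸ i))))
    Δ-pow a m s = begin
      pow R (a + s) m - pow R (- a + s) m
        ≈⟨ +-cong (pow-cong m (+-comm a s)) (-‿cong (pow-cong m (+-comm (- a) s))) ⟩
      pow R (s + a) m - pow R (s + - a) m
        ≈⟨ +-cong (binomial m s a) (-‿cong (binomial m s (- a))) ⟩
      sumTo R (suc m) (λ i → fromℕ R (m C i) * (pow R s i * pow R a (m ∸ i)))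
        - sumTo R (suc m) (λ i → fromℕ R (m C i) * (pow R s i * pow R (- a) (m ∸ i)))
        ≈⟨ sumTo-sub (suc m) _ _ ⟨
      sumTo R (suc m) (λ i → fromℕ R (m C i) * (pow R s i * pow R a (m ∸ i))
                             - fromℕ R (m C i) * (pow R s i * pow R (- a) (m ∸ i)))
        ≈⟨ sumTo-cong (suc m) (λ i → trans (sym (x[y-z]≈xy-xz _ _ _)) (*-congˡ (sym (x[y-z]≈xy-xz _ _ _)))) ⟩
      sumTo R (suc m) (λ i → fromℕ R (m C i) * (pow R s i * (pow R a (m ∸ i) - pow R (- a) (m ∸ i)))) ∎

    sinhProdCoeff-signSum : ∀ t m → pow R 2# t * sinhProdCoeff R ω t m ≈ signSum 0 t (λ s → pow R s m)
    sinhProdCoeff-signSum zero zero    = sym (+-identityʳ _)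
    sinhProdCoeff-signSum zero (suc m) = trans (*-congˡ (sym (zeroˡ _))) (sym (+-identityʳ _))
    sinhProdCoeff-signSum (suc t) m = begin
      (2# * pow R 2# t) * sumTo R (suc m) (λ i → binom i * (sinhProdCoeff R ω t i * sinhCoeff R a (m ∸ i)))
        ≈⟨ sumTo-*ˡ (suc m) _ _ ⟩
      sumTo R (suc m) (λ i → (2# * pow R 2# t) * (binom i * (sinhProdCoeff R ω t i * sinhCoeff R a (m ∸ i))))
        ≈⟨ sumTo-cong (suc m) term ⟩
      sumTo R (suc m) (λ i → signSum 0 t (λ s → binom i * (pow R s i * twiceSinh i)))
        ≈⟨ signSum-sumTo 0 t (suc m) (λ i s → binom i * (pow R s i * twiceSinh i)) ⟨
      signSum 0 t (λ s → sumTo R (suc m) (λ i → binom i * (pow R s i * twiceSinh i)))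
        ≈⟨ signSum-cong 0 t (λ s → Δ-pow a m s) ⟨
      signSum 0 t (Δ a (λ s → pow R s m))
        ≈⟨ signSum-sucʳ 0 t (pow-cong m) ⟨
      signSum 0 (suc t) (λ s → pow R s m) ∎
      where
      a : Carrier
      a = pow R ω t

      binom twiceSinh : ℕ → Carrier
      binom i = fromℕ R (m C i)
      twiceSinh i = pow R a (m ∸ i) - pow R (- a) (m ∸ i)

      term : ∀ i → (2# * pow R 2# t) * (binom i * (sinhProdCoeff R ω t i * sinhCoeff R a (m ∸ i)))
                   ≈ signSum 0 t (λ s → binom i * (pow R s i * twiceSinh i))
      term i = begin
        (2# * pow R 2# t) * (binom i * (sinhProdCoeff R ω t i * sinhCoeff R a (m ∸ i)))
          ≈⟨ solve 5 (λ d dᵗ c p h → (d :* dᵗ) :* (c :* (p :* h)) := c :* ((dᵗ :* p) :* (d :* h))) refl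
               2# (pow R 2# t) (binom i) (sinhProdCoeff R ω t i) (sinhCoeff R a (m ∸ i)) ⟩
        binom i * ((pow R 2# t * sinhProdCoeff R ω t i) * (2# * sinhCoeff R a (m ∸ i)))
          ≈⟨ *-congˡ (*-cong (sinhProdCoeff-signSum t i) (sinhCoeff-double a (m ∸ i))) ⟩
        binom i * (signSum 0 t (λ s → pow R s i) * twiceSinh i)
          ≈⟨ solve 3 (λ c x d → c :* (x :* d) := (c :* d) :* x) refl
               (binom i) (signSum 0 t (λ s → pow R s i)) (twiceSinh i) ⟩
        (binom i * twiceSinh i) * signSum 0 t (λ s → pow R s i)
          ≈⟨ signSum-*ˡ 0 t (binom i * twiceSinh i) (λ s → pow R s i) ⟨
        signSum 0 t (λ s → (binom i * twiceSinh i) * pow R s i)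
          ≈⟨ signSum-cong 0 t (λ s → solve 3 (λ c d x → (c :* d) :* x := c :* (x :* d)) refl
                                       (binom i) (twiceSinh i) (pow R s i)) ⟩
        signSum 0 t (λ s → binom i * (pow R s i * twiceSinh i)) ∎

    sinhProdCoeff≈signSum : ∀ {half} → 2# * half ≈ 1# → ∀ t m →
      sinhProdCoeff R ω t m ≈ pow R half t * signSum 0 t (λ s → pow R s m)
    sinhProdCoeff≈signSum {half} 2half≈1 t m = begin
      sinhProdCoeff R ω t m                               ≈⟨ *-identityˡ _ ⟨
      1# * sinhProdCoeff R ω t m
        ≈⟨ *-congʳ (trans (pow-cong t (trans (*-comm half 2#) 2half≈1)) (pow-1# t)) ⟨
      pow R (half * 2#) t * sinhProdCoeff R ω t m         ≈⟨ *-congʳ (pow-* half 2# t) ⟩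
      (pow R half t * pow R 2# t) * sinhProdCoeff R ω t m ≈⟨ *-assoc _ _ _ ⟩
      pow R half t * (pow R 2# t * sinhProdCoeff R ω t m) ≈⟨ *-congˡ (sinhProdCoeff-signSum t m) ⟩
      pow R half t * signSum 0 t (λ s → pow R s m)        ∎

    sinhProdCoeff-binomial : ∀ {half} → 2# * half ≈ 1# → ∀ t m w →
      sumTo R (suc m) (λ i → sinhProdCoeff R ω t i * (fromℕ R (m C i) * pow R w (m ∸ i)))
        ≈ pow R half t * signSum 0 t (λ s → pow R (w + s) m)
    sinhProdCoeff-binomial {half} 2half≈1 t m w = begin
      sumTo R (suc m) (λ i → sinhProdCoeff R ω t i * b i)
        ≈⟨ sumTo-cong (suc m) term ⟩
      sumTo R (suc m) (λ i → pow R half t * signSum 0 t (binomialTerm i))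
        ≈⟨ sumTo-*ˡ (suc m) _ _ ⟨
      pow R half t * sumTo R (suc m) (λ i → signSum 0 t (binomialTerm i))
        ≈⟨ *-congˡ (signSum-sumTo 0 t (suc m) binomialTerm) ⟨
      pow R half t * signSum 0 t (λ s → sumTo R (suc m) (λ i → binomialTerm i s))
        ≈⟨ *-congˡ (signSum-cong 0 t (λ s → trans (sym (binomial m s w)) (pow-cong m (+-comm s w)))) ⟩
      pow R half t * signSum 0 t (λ s → pow R (w + s) m) ∎
      where
      b : ℕ → Carrier
      b i = fromℕ R (m C i) * pow R w (m ∸ i)

      binomialTerm : ℕ → Carrier → Carrier
      binomialTerm i s = fromℕ R (m C i) * (pow R s i * pow R w (m ∸ i))

      term : ∀ i → sinhProdCoeff R ω t i * b i ≈ pow R half t * signSum 0 t (binomialTerm i)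
      term i = begin
        sinhProdCoeff R ω t i * b i
          ≈⟨ *-congʳ (sinhProdCoeff≈signSum 2half≈1 t i) ⟩
        (pow R half t * signSum 0 t (λ s → pow R s i)) * b i
          ≈⟨ solve 3 (λ h x y → (h :* x) :* y := h :* (y :* x)) refl
               (pow R half t) (signSum 0 t (λ s → pow R s i)) (b i) ⟩
        pow R half t * (b i * signSum 0 t (λ s → pow R s i))
          ≈⟨ *-congˡ (signSum-*ˡ 0 t (b i) (λ s → pow R s i)) ⟨
        pow R half t * signSum 0 t (λ s → b i * pow R s i)
          ≈⟨ *-congˡ (signSum-cong 0 t (λ s → solve 3 (λ c y x → (c :* y) :* x := c :* (x :* y)) refl
                                                (fromℕ R (m C i)) (pow R w (m ∸ i)) (pow R s i))) ⟩
        pow R half t * signSum 0 t (binomialTerm i) ∎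

    signSum-pow≈0 : (∀ x y → x * y ≈ 0# → (x ≈ 0#) ⊎ (y ≈ 0#)) → ∀ t → pow R ω (suc t) ≈ - 1# →
      ∀ i → ¬ (pow R ω i ≈ - 1#) → signSum 0 (suc t) (λ s → pow R s i) ≈ 0#
    signSum-pow≈0 noZeroDivisors t ωᴺ≈-1 i ωⁱ≉-1
      with noZeroDivisors _ _ (signSum-pow-annihilated t ωᴺ≈-1 i)
    ... | inj₁ ωⁱ+1≈0 = ⊥-elim (ωⁱ≉-1 (+-inverseˡ-unique _ _ ωⁱ+1≈0))
    ... | inj₂ X≈0    = X≈0

theorem2 : ∀ {c ℓ} (R : CommutativeRing c ℓ) →
    let open CommutativeRing R in
    ¬ (1# ≈ 0#) →
    (∀ x y → x * y ≈ 0# → (x ≈ 0#) ⊎ (y ≈ 0#)) →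
    (half : Carrier) → (1# + 1#) * half ≈ 1# →
    (N : ℕ) → 1 ≤ N →
    (ω : Carrier) → pow R ω N ≈ - 1# →
    (∀ d → 1 ≤ d → d < 2 ℕ.* N → ¬ (pow R ω d ≈ 1#)) →
    (n p : ℕ) → (w : Carrier) →
    sumTo R (suc (n ℕ.+ p))
        (λ k → alpha R ω N k * (fromℕ R (Mval N n p C (2 ℕ.* k ℕ.* N ℕ.+ N))
                 * pow R w (Mval N n p ∸ (2 ℕ.* k ℕ.* N ℕ.+ N))))
      ≈ pow R half N * sumList R (allSigns N)
          (λ ε → signature R ε * pow R (w + signedSum R ω ε) (Mval N n p))
theorem2 R _ noZeroDivisors half 2half≈1 (suc t) _ ω ωᴺ≈-1 ω-primitive n p w = begin
  sumTo R K (λ k → T (2 ℕ.* k ℕ.* N ℕ.+ N))  ≈⟨ sumTo-cong K (λ k → reflexive (≡.cong T (blockIndex k t))) ⟩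
  sumTo R K (λ k → T (k ℕ.* q ℕ.+ N))        ≈⟨ sumTo-sparse K T (ℕₚ.m<m+n N (s≤s z≤n)) T-sparse ⟨
  sumTo R (K ℕ.* q) T                         ≈⟨ sumTo-extend T 1+M≤Kq T-beyond ⟩
  sumTo R (suc M) T                           ≈⟨ sinhProdCoeff-binomial 2half≈1 N M w ⟩
  pow R half N * signSum 0 N (λ s → pow R (w + s) M) ∎
  where
  open CommutativeRing R
  open SetoidReasoning setoid
  open Properties R
  open SignSums ω

  N q M K : ℕ
  N = suc t
  q = 2 ℕ.* N
  M = Mval N n p
  K = suc (n ℕ.+ p)

  T : ℕ → Carrier
  T i = sinhProdCoeff R ω N i * (fromℕ R (M C i) * pow R w (M ∸ i))

  T-sparse : ∀ i → i % q ≢ N → T i ≈ 0#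
  T-sparse i i≢N = begin
    T i
      ≈⟨ *-congʳ (sinhProdCoeff≈signSum 2half≈1 N i) ⟩
    (pow R half N * signSum 0 N (λ s → pow R s i)) * (fromℕ R (M C i) * pow R w (M ∸ i))
      ≈⟨ *-congʳ (*-congˡ (signSum-pow≈0 noZeroDivisors t ωᴺ≈-1 i ωⁱ≉-1)) ⟩
    (pow R half N * 0#) * (fromℕ R (M C i) * pow R w (M ∸ i))
      ≈⟨ trans (*-congʳ (zeroʳ _)) (zeroˡ _) ⟩
    0# ∎
    where
    ωⁱ≉-1 : ¬ (pow R ω i ≈ - 1#)
    ωⁱ≉-1 ωⁱ≈-1 = i≢N (pow≈-1⇒%≡ t ωᴺ≈-1 ω-primitive i ωⁱ≈-1)

  T-beyond : ∀ i → suc M ≤ i → T i ≈ 0#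
  T-beyond i M<i =
    trans (*-congˡ (trans (*-congʳ (reflexive (≡.cong (fromℕ R) (k>n⇒nCk≡0 M<i)))) (zeroˡ _))) (zeroʳ _)

  blockIndex : ∀ k t → 2 ℕ.* k ℕ.* suc t ℕ.+ suc t ≡ k ℕ.* (2 ℕ.* suc t) ℕ.+ suc t
  blockIndex = solve-∀

  1+M≤Kq : suc M ≤ K ℕ.* q
  1+M≤Kq = ≡.subst (suc M ≤_) (padding n p t) (ℕₚ.m≤m+n (suc M) _)
    where
    padding : ∀ n p t → suc (2 ℕ.* n ℕ.* suc t ℕ.+ suc t ℕ.+ 2 ℕ.* p) ℕ.+ (2 ℕ.* p ℕ.* t ℕ.+ t)
                        ≡ suc (n ℕ.+ p) ℕ.* (2 ℕ.* suc t)
    padding = solve-∀
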